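{- If $\Gamma \vdash \mathbb{M}:\tau$ and $\mathbb{M} \longrightarrow \mathbb{M}'$ then $\Gamma \vdash \mathbb{M}' :\tau$.
   Context: $\widehat{\lambda}_{\oplus}$ is the fragment of the sharing calculus $\widehat{\lambda}^{\text{↯}}_{\oplus}$ without $\mathtt{fail}$: terms $M ::= x \mid \lambda x.(M[\widetilde{x}\leftarrow x]) \mid M\,B \mid M\langle\!\langle N/x\rangle\!\rangle \mid M[\widetilde{x}\leftarrow x] \mid (M[\widetilde{x}\leftarrow x])\langle B/x\rangle$, bags (multisets), expressions = sums. Reduction rules: $(\lambda x.M[\widetilde{x}\leftarrow x])B\longrightarrow M[\widetilde{x}\leftarrow x]\langle B/x\rangle$; $M[x_1,\dots,x_k\leftarrow x]\langle B/x\rangle\longrightarrow\sum_{B_i\in\mathrm{PER}(B)}M\langle\!\langle B_i(1)/x_1\rangle\!\rangle\cdots\langle\!\langle B_i(k)/x_k\rangle\!\rangle$ ($|B|=k\ge1$); $M\langle\!\langle N/x\rangle\!\rangle\longrightarrow M\{\!|N/x|\!\}$ if $\mathrm{head}(M)=x$ (linear head substitution); closure under term and sum contexts. $\vdash$ is the non-idempotent intersection type system (strict types $\sigma::=\mathbf{unit}\mid\pi\to\sigma$, multiset types $\bigwedge_i\sigma_i\mid\omega$) with sharing rule $\Delta,x_1{:}\sigma,\dots,x_k{:}\sigma\vdash M:\tau \Rightarrow \Delta,x{:}\sigma^k\vdash M[x_1,\dots,x_k\leftarrow x]:\tau$ ($k\ne0$), weakening $M[\leftarrow x]$ with $x:\omega$,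 abstraction over a shared variable, application and explicit substitution requiring exact match of bag type $\sigma^k$, explicit linear substitution consuming one $x:\sigma$, and a sum rule. -}

module Defs where

open import Data.Nat using (ℕ; suc; _≟_)
open import Data.List using (List; []; _∷_; [_]; _++_; map; concatMap; replicate; length; filter)
open import Data.Product using (_×_; _,_; proj₁)
open import Relation.Nullary using (¬_)
open import Relation.Nullary.Decidable using (¬?; yes; no)
open import Relation.Binary.PropositionalEquality using (_≡_; _≢_)
open import Data.List.Membership.Propositional using (_∉_)
open import Data.List.Membership.DecPropositional _≟_ using (_∈?_)
open import Data.List.Relation.Binary.Permutation.Propositional using (_↭_)
open import Data.List.Relation.Binary.Disjoint.Propositional using (Disjoint)
open import Data.List.Relation.Unary.Unique.Propositional using (Unique)
open import Data.List.Relation.Unary.All using (All)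

-- Syntax of the sharing calculus  λ̂⊕  (fragment of λ̂^↯⊕ without fail)

Var : Set
Var = ℕ

-- Terms.  Bags are multisets of terms, represented as lists
-- (their order is irrelevant: reduction sums over all permutations,
-- and typing of bags is order-independent).
data Term : Set where
  var   : Var → Term
  lam   : Var → Term → List Var → Term            -- lam x M xs   =  λx.(M[xs ← x])
  app   : Term → List Term → Term
  lsub  : Term → Term → Var → Term
  share : Term → List Var → Var → Term            -- share M xs x =  M[xs ← x]   (xs = [] : weakening M[← x])
  esub  : Term → List Var → Var → List Term → Term  -- esub M xs x B = (M[xs ← x])⟨B/x⟩

Bag : Set
Bag = List Term

-- Expressions: finite non-empty formal sums  M₁ + ... + Mₙ  (as lists)
Expr : Set
Expr = List Term

headShare : Term → List Var → Var → Term
headShare (var y) xs x with y ∈? xs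
... | yes _ = var x
... | no  _ = var y
headShare h xs x = h

head : Term → Term
head (var x)          = var x
head (lam x M xs)     = lam x M xs
head (app M B)        = head M
head (lsub M N x)     = head M
head (share M xs x)   = headShare (head M) xs x
head (esub M xs x B)  = headShare (head M) xs x   -- = head (M[xs ← x])

-- Linear head substitution  M {| N / x |} = M'  (a partial operation,
-- given as its graph)

data HSub : Term → Term → Var → Term → Set where
  hs-var   : ∀ {N x} → HSub (var x) N x N
  hs-app   : ∀ {M N x M' B} → HSub M N x M' → HSub (app M B) N x (app M' B)
  hs-lsub  : ∀ {M N x M' L y} → HSub M N x M' → HSub (lsub M L y) N x (lsub M' L y)
  hs-share : ∀ {M N x M' ys y} → x ≢ y → HSub M N x M' →
             HSub (share M ys y) N x (share M' ys y)
  hs-esub  : ∀ {M N x M' ys y B} → x ≢ y → HSub M N x M' →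
             HSub (esub M ys y B) N x (esub M' ys y B)

insertions : {A : Set} → A → List A → List (List A)
insertions a []       = [ a ∷ [] ]
insertions a (b ∷ bs) = (a ∷ b ∷ bs) ∷ map (b ∷_) (insertions a bs)

perms : {A : Set} → List A → List (List A)
perms []       = [ [] ]
perms (a ∷ as) = concatMap (insertions a) (perms as)

lsubs : Term → List Var → List Term → Term
lsubs M (x ∷ xs) (N ∷ Ns) = lsubs (lsub M N x) xs Ns
lsubs M _        _        = M

infix 4 _⟶_ _⟶ₑ_

data _⟶_ : Term → Expr → Set where
  r-beta   : ∀ {x M xs B} → app (lam x M xs) B ⟶ [ esub M xs x B ]
  r-exsub  : ∀ {M xs x B} → length B ≡ length xs → length xs ≢ 0 →
             esub M xs x B ⟶ map (lsubs M xs) (perms B)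
  r-lin    : ∀ {M N x M'} → head M ≡ var x → HSub M N x M' →
             lsub M N x ⟶ [ M' ]
  c-app    : ∀ {M 𝕄 B} → M ⟶ 𝕄 → app M B ⟶ map (λ M' → app M' B) 𝕄
  c-lsub   : ∀ {M 𝕄 N x} → M ⟶ 𝕄 → lsub M N x ⟶ map (λ M' → lsub M' N x) 𝕄
  c-share  : ∀ {M 𝕄 xs x} → M ⟶ 𝕄 → share M xs x ⟶ map (λ M' → share M' xs x) 𝕄
  c-esub   : ∀ {M 𝕄 xs x B} → M ⟶ 𝕄 → esub M xs x B ⟶ map (λ M' → esub M' xs x B) 𝕄

data _⟶ₑ_ : Expr → Expr → Set where
  c-sum : ∀ {𝕃 M 𝕄 ℕ'} → M ⟶ 𝕄 → (𝕃 ++ M ∷ ℕ') ⟶ₑ (𝕃 ++ 𝕄 ++ ℕ')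

data Strict : Set where
  unit : Strict
  _⇒_  : List Strict → Strict → Strict

-- multiset (intersection) types:  ∧ σᵢ  (as a list);  ω = empty
MType : Set
MType = List Strict

ω : MType
ω = []

_^_ : Strict → ℕ → MType
σ ^ k = replicate k σ

-- type assignments in contexts:  x : σ  (linear)  or  x : π  (shared)
data Asg : Set where
  lin : Strict → Asg
  mul : MType → Asg

-- contexts (multisets of assignments; compared up to permutation)
Ctx : Set
Ctx = List (Var × Asg)

dom : Ctx → List Var
dom = map proj₁

_≈_,,_ : Ctx → Ctx → Ctx → Set
Θ ≈ Γ ,, Δ = (Θ ↭ Γ ++ Δ) × Disjoint (dom Γ) (dom Δ)

infix 4 _⊢_∶_ _⊢ᵇ_∶_ _⊢ₑ_∶_
infix 4 _≈_,,_

mutual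
  data _⊢_∶_ : Ctx → Term → Strict → Set where
    T-var   : ∀ {x σ} → ((x , lin σ) ∷ []) ⊢ var x ∶ σ
    T-weak  : ∀ {Γ Θ M x τ} → Γ ⊢ M ∶ τ → x ∉ dom Γ →
              Θ ↭ (x , mul ω) ∷ Γ →
              Θ ⊢ share M [] x ∶ τ
    T-share : ∀ {Δ Θ' Θ M xs x σ τ} → Θ' ⊢ M ∶ τ →
              Θ' ↭ Δ ++ map (λ y → (y , lin σ)) xs →
              xs ≢ [] → x ∉ dom Δ →
              Θ ↭ (x , mul (σ ^ length xs)) ∷ Δ →
              Θ ⊢ share M xs x ∶ τ
    T-abs   : ∀ {Δ Θ' M xs x σ k τ} → Θ' ⊢ share M xs x ∶ τ →
              Θ' ↭ (x , mul (σ ^ k)) ∷ Δ → x ∉ dom Δ →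
              Δ ⊢ lam x M xs ∶ ((σ ^ k) ⇒ τ)
    T-app   : ∀ {Γ Δ Θ M B σ k τ} → Γ ⊢ M ∶ ((σ ^ k) ⇒ τ) → Δ ⊢ᵇ B ∶ (σ ^ k) →
              Θ ≈ Γ ,, Δ →
              Θ ⊢ app M B ∶ τ
    T-esub  : ∀ {Γ Δ Θ' Θ M xs x B σ k τ} → Γ ⊢ᵇ B ∶ (σ ^ k) →
              Θ' ⊢ share M xs x ∶ τ → Θ' ↭ (x , mul (σ ^ k)) ∷ Δ →
              Θ ≈ Γ ,, Δ →
              Θ ⊢ esub M xs x B ∶ τ
    T-lsub  : ∀ {Γ Δ Θ' Θ M N x σ τ} → Γ ⊢ N ∶ σ →
              Θ' ⊢ M ∶ τ → Θ' ↭ (x , lin σ) ∷ Δ →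
              Θ ≈ Γ ,, Δ →
              Θ ⊢ lsub M N x ∶ τ

  data _⊢ᵇ_∶_ : Ctx → Bag → MType → Set where
    T-one   : [] ⊢ᵇ [] ∶ ω
    T-bag   : ∀ {Γ Δ Θ M B σ k} → Γ ⊢ M ∶ σ → Δ ⊢ᵇ B ∶ (σ ^ k) →
              Θ ≈ Γ ,, Δ →
              Θ ⊢ᵇ (M ∷ B) ∶ (σ ^ suc k)

data _⊢ₑ_∶_ : Ctx → Expr → Strict → Set where
  T-term : ∀ {Γ M τ} → Γ ⊢ M ∶ τ → Γ ⊢ₑ [ M ] ∶ τ
  T-sum  : ∀ {Γ M 𝕄 τ} → Γ ⊢ M ∶ τ → Γ ⊢ₑ 𝕄 ∶ τ → Γ ⊢ₑ (M ∷ 𝕄) ∶ τ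

_minus_ : List Var → List Var → List Var
ys minus xs = filter (λ y → ¬? (y ∈? xs)) ys

mutual
  bv : Term → List Var
  bv (var x)         = []
  bv (lam x M xs)    = x ∷ xs ++ bv M
  bv (app M B)       = bv M ++ bvs B
  bv (lsub M N x)    = x ∷ bv M ++ bv N
  bv (share M xs x)  = xs ++ bv M
  bv (esub M xs x B) = x ∷ xs ++ bv M ++ bvs B

  bvs : Bag → List Var
  bvs []      = []
  bvs (M ∷ B) = bv M ++ bvs B

mutual
  fv : Term → List Var
  fv (var x)         = x ∷ []
  fv (lam x M xs)    = fv M minus xs
  fv (app M B)       = fv M ++ fvs B
  fv (lsub M N x)    = (fv M minus (x ∷ [])) ++ fv N
  fv (share M xs x)  = x ∷ (fv M minus xs)
  fv (esub M xs x B) = (fv M minus xs) ++ fvs B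

  fvs : Bag → List Var
  fvs []      = []
  fvs (M ∷ B) = fv M ++ fvs B

VarConv : Term → Set
VarConv M = Unique (bv M) × Disjoint (bv M) (fv M)

VarConvₑ : Expr → Set
VarConvₑ 𝕄 = All VarConv 𝕄

{-# OPTIONS --safe #-}
-- For β the shared assignment x : σᵏ of the
-- abstraction meets a bag of type σᵏ, giving the explicit substitution.
-- Distributing ⟨B/x⟩ over x₁,…,xₖ works for every permutation of B because all
-- elements of B have the same type σ, so each xᵢ : σ receives one of them
-- together with its share of the bag's context.  Linear head substitution
-- consumes the unique assignment x : σ at the head and replaces it by the
-- context of N; the variable convention guarantees that no binder passed on
-- the way to the head captures a variable of N's context.
module Submission where

open import Defs
open import Data.Empty using (⊥-elim)
open import Data.List using (List; []; _∷_; [_]; _++_; map; length)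
import Data.List.Properties as List
open import Data.List.Membership.Propositional using (_∈_; _∉_)
open import Data.List.Membership.Propositional.Properties
  using (∈-++⁺ˡ; ∈-++⁺ʳ; ∈-++⁻; ∈-map⁺; ∈-map⁻; ∈-∃++; ∈-filter⁺; ∈-concat⁻′)
open import Data.Nat using (_≟_)
open import Data.List.Membership.DecPropositional _≟_ using (_∈?_)
open import Data.List.Relation.Binary.Disjoint.Propositional using (Disjoint)
import Data.List.Relation.Binary.Disjoint.Propositional.Properties as Disjoint
open import Data.List.Relation.Binary.Permutation.Propositional
import Data.List.Relation.Binary.Permutation.Propositional.Properties as ↭
import Data.List.Relation.Binary.Permutation.Setoid.Properties as ↭ₛ
open import Data.List.Relation.Binary.Subset.Propositional using (_⊆_)
import Data.List.Relation.Binary.Subset.Propositional.Properties as ⊆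
open import Data.List.Relation.Unary.All as All using (All; []; _∷_)
import Data.List.Relation.Unary.All.Properties as All
open import Data.List.Relation.Unary.Any using (here; there)
open import Data.List.Relation.Unary.Unique.Propositional using (Unique; []; _∷_)
import Data.List.Relation.Unary.Unique.Propositional.Properties as Unique
open import Data.Nat.Properties using (suc-injective)
open import Data.Product using (∃; _×_; _,_; proj₁; proj₂)
open import Data.Sum using (_⊎_; inj₁; inj₂)
import Data.Sum as Sum
open import Function using (_∘_; id)
open import Relation.Binary.PropositionalEquality
  using (_≡_; _≢_; refl; sym; cong; subst; setoid)
import Relation.Binary.PropositionalEquality as ≡
open import Relation.Nullary using (yes; no)
open import Relation.Nullary.Decidable using (¬?)

private
  variable
    A : Set
    xs ys : List A
    x y z : Var
    vs : List Var
    Γ Γ₁ Γ₂ Γ₃ Δ Δ' Θ Θ' : Ctx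
    q r : Var × Asg
    a b : Asg
    M M' N : Term
    B B' Ns : Bag
    𝕄 : Expr
    σ τ : Strict
    π π' : MType

Unique-resp-↭ : xs ↭ ys → Unique xs → Unique ys
Unique-resp-↭ p = ↭ₛ.Unique-resp-↭ (setoid _) (↭⇒↭ₛ p)

Unique-++⁻ : ∀ (xs : List A) → Unique (xs ++ ys) → Unique xs × Unique ys × Disjoint xs ys
Unique-++⁻ []       u          = [] , u , λ ()
Unique-++⁻ (x ∷ xs) (x∉ ∷ u) with Unique-++⁻ xs u
... | uxs , uys , xs#ys = All.++⁻ˡ xs x∉ ∷ uxs , uys , λ
  { (here refl , x∈ys)   → All.lookup (All.++⁻ʳ xs x∉) x∈ys refl
  ; (there v∈xs , v∈ys) → xs#ys (v∈xs , v∈ys) }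

Disjoint-⊆ : ∀ {xs' ys' : List A} → xs' ⊆ xs → ys' ⊆ ys → Disjoint xs ys → Disjoint xs' ys'
Disjoint-⊆ xs'⊆xs ys'⊆ys xs#ys (v∈xs' , v∈ys') = xs#ys (xs'⊆xs v∈xs' , ys'⊆ys v∈ys')

Disjoint[xs,y∷ys]⇒y∉xs : ∀ {y : A} → Disjoint xs (y ∷ ys) → y ∉ xs
Disjoint[xs,y∷ys]⇒y∉xs xs#y∷ys y∈xs = xs#y∷ys (y∈xs , here refl)

Disjoint-∷ʳ : ∀ {y : A} → y ∉ xs → Disjoint xs ys → Disjoint xs (y ∷ ys)
Disjoint-∷ʳ y∉xs xs#ys (v∈xs , here refl)   = y∉xs v∈xs
Disjoint-∷ʳ y∉xs xs#ys (v∈xs , there v∈ys) = xs#ys (v∈xs , v∈ys)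

∈⇒↭∷ : ∀ {x : A} → x ∈ xs → ∃ λ xs' → xs ↭ x ∷ xs'
∈⇒↭∷ {x = x} x∈xs with ∈-∃++ x∈xs
... | us , ws , refl = us ++ ws , ↭.shift x us ws

∈-minus⁺ : z ∈ vs → z ∉ ys → z ∈ vs minus ys
∈-minus⁺ {ys = ys} = ∈-filter⁺ (λ y → ¬? (y ∈? ys))

map-≢[] : ∀ {C : Set} (f : A → C) → xs ≢ [] → map f xs ≢ []
map-≢[] {xs = []}    f xs≢[] _ = xs≢[] refl
map-≢[] {xs = _ ∷ _} f _     ()

insertions-↭ : ∀ (a : A) xs → ys ∈ insertions a xs → ys ↭ a ∷ xs
insertions-↭ a []       (here refl) = ↭-refl
insertions-↭ a (b ∷ xs) (here refl) = ↭-refl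
insertions-↭ a (b ∷ xs) (there ys∈) with ∈-map⁻ (b ∷_) ys∈
... | ys , ys∈' , refl = ↭-trans (prep b (insertions-↭ a xs ys∈')) (swap b a ↭-refl)

perms-↭ : ∀ (xs : List A) → ys ∈ perms xs → ys ↭ xs
perms-↭ []       (here refl) = ↭-refl
perms-↭ (a ∷ xs) ys∈ with ∈-concat⁻′ (map (insertions a) (perms xs)) ys∈
... | _ , ys∈ins , ins∈ with ∈-map⁻ (insertions a) ins∈
...   | zs , zs∈ , refl = ↭-trans (insertions-↭ a zs ys∈ins) (prep a (perms-↭ xs zs∈))

perms-≢[] : ∀ (xs : List A) → perms xs ≢ []
perms-≢[] []       ()
perms-≢[] (a ∷ xs) eq with perms xs | perms-≢[] xs
... | []     | ps≢[] = ps≢[] refl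
... | p ∷ ps | _     = insertions-≢[] p (List.++-conicalˡ (insertions a p) _ eq)
  where
  insertions-≢[] : ∀ ys → insertions a ys ≢ []
  insertions-≢[] []      ()
  insertions-≢[] (_ ∷ _) ()

_#_ : Ctx → Ctx → Set
Γ # Δ = Disjoint (dom Γ) (dom Δ)

lins : Strict → List Var → Ctx
lins σ vs = map (λ y → (y , lin σ)) vs

dom-lins : ∀ σ vs → dom (lins σ vs) ≡ vs
dom-lins σ []       = refl
dom-lins σ (v ∷ vs) = cong (v ∷_) (dom-lins σ vs)

∈-dom : q ∈ Γ → proj₁ q ∈ dom Γ
∈-dom = ∈-map⁺ proj₁

∈-head : Θ ↭ q ∷ Δ → q ∈ Θ
∈-head p = ↭.∈-resp-↭ (↭-sym p) (here refl)

∈-mul∷⁻ : (x , lin σ) ∈ (y , mul π) ∷ Γ → (x , lin σ) ∈ Γ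
∈-mul∷⁻ (here ())
∈-mul∷⁻ (there x∈Γ) = x∈Γ

dom-⊆-↭ : Θ ↭ Θ' → dom Θ ⊆ dom Θ'
dom-⊆-↭ p = ⊆.⊆-reflexive-↭ (↭.map⁺ proj₁ p)

dom-⊆-++ˡ : ∀ Γ Δ → dom Γ ⊆ dom (Γ ++ Δ)
dom-⊆-++ˡ Γ Δ = subst (dom Γ ⊆_) (sym (List.map-++ proj₁ Γ Δ)) (⊆.xs⊆xs++ys (dom Γ) (dom Δ))

dom-⊆-++ʳ : ∀ Γ Δ → dom Δ ⊆ dom (Γ ++ Δ)
dom-⊆-++ʳ Γ Δ = subst (dom Δ ⊆_) (sym (List.map-++ proj₁ Γ Δ)) (⊆.xs⊆ys++xs (dom Δ) (dom Γ))

dom-++⁻ : ∀ Γ Δ → z ∈ dom (Γ ++ Δ) → z ∈ dom Γ ⊎ z ∈ dom Δ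
dom-++⁻ Γ Δ = ∈-++⁻ (dom Γ) ∘ subst (_ ∈_) (List.map-++ proj₁ Γ Δ)

dom-lins-++⁻ : ∀ Δ → z ∈ dom (Δ ++ lins σ vs) → z ∈ dom Δ ⊎ z ∈ vs
dom-lins-++⁻ {σ = σ} {vs = vs} Δ = Sum.map₂ (subst (_ ∈_) (dom-lins σ vs)) ∘ dom-++⁻ Δ (lins σ vs)

dom-∷⁻ : Θ ↭ r ∷ Δ → z ∈ dom Θ → z ≢ proj₁ r → z ∈ dom Δ
dom-∷⁻ p z∈Θ z≢r with dom-⊆-↭ p z∈Θ
... | here z≡r  = ⊥-elim (z≢r z≡r)
... | there z∈Δ = z∈Δ

Unique-dom-∷⁻ : Θ ↭ r ∷ Δ → Unique (dom Θ) → proj₁ r ∉ dom Δ × Unique (dom Δ)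
Unique-dom-∷⁻ p u with Unique-resp-↭ (↭.map⁺ proj₁ p) u
... | r∉Δ ∷ uΔ = (λ r∈Δ → All.lookup r∉Δ r∈Δ refl) , uΔ

↭-∷-under : Θ ↭ r ∷ Δ → Δ ↭ q ∷ Δ' → Θ ↭ q ∷ r ∷ Δ'
↭-∷-under p e = ↭-trans p (↭-trans (prep _ e) (swap _ _ ↭-refl))

↭-∷-fresh-injective : Θ ↭ (x , a) ∷ Δ → Θ ↭ (x , b) ∷ Δ' → x ∉ dom Δ' → a ≡ b × Δ ↭ Δ'
↭-∷-fresh-injective p p' x∉Δ' with ↭.∈-resp-↭ p' (∈-head p)
... | here refl    = refl , ↭.drop-∷ (↭-trans (↭-sym p) p')
... | there xa∈Δ' = ⊥-elim (x∉Δ' (∈-dom xa∈Δ'))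

#-sym : Γ # Δ → Δ # Γ
#-sym = Disjoint.sym

#-++ʳ : ∀ Δ₁ Δ₂ → Γ # Δ₁ → Γ # Δ₂ → Γ # (Δ₁ ++ Δ₂)
#-++ʳ Δ₁ Δ₂ Γ#Δ₁ Γ#Δ₂ (z∈Γ , z∈Δ) with dom-++⁻ Δ₁ Δ₂ z∈Δ
... | inj₁ z∈Δ₁ = Γ#Δ₁ (z∈Γ , z∈Δ₁)
... | inj₂ z∈Δ₂ = Γ#Δ₂ (z∈Γ , z∈Δ₂)

≈-⊆ˡ : ∀ Γ Δ → Θ ≈ Γ ,, Δ → dom Γ ⊆ dom Θ
≈-⊆ˡ Γ Δ (s , _) = dom-⊆-↭ (↭-sym s) ∘ dom-⊆-++ˡ Γ Δ

≈-⊆ʳ : ∀ Γ Δ → Θ ≈ Γ ,, Δ → dom Δ ⊆ dom Θ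
≈-⊆ʳ Γ Δ (s , _) = dom-⊆-↭ (↭-sym s) ∘ dom-⊆-++ʳ Γ Δ

≈-dom⁻ : ∀ Γ Δ → Θ ≈ Γ ,, Δ → z ∈ dom Θ → z ∈ dom Γ ⊎ z ∈ dom Δ
≈-dom⁻ Γ Δ (s , _) = dom-++⁻ Γ Δ ∘ dom-⊆-↭ s

≈-comm : Θ ≈ Γ ,, Δ → Θ ≈ Δ ,, Γ
≈-comm {Γ = Γ} {Δ = Δ} (s , Γ#Δ) = ↭-trans s (↭.++-comm Γ Δ) , #-sym Γ#Δ

≈-singleton : Θ ↭ r ∷ Δ → proj₁ r ∉ dom Δ → Θ ≈ [ r ] ,, Δ
≈-singleton p r∉Δ = p , λ { (here refl , r∈Δ) → r∉Δ r∈Δ }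

Unique-dom-≈ : Θ ≈ Γ ,, Δ → Unique (dom Γ) → Unique (dom Δ) → Unique (dom Θ)
Unique-dom-≈ {Γ = Γ} {Δ = Δ} (s , Γ#Δ) uΓ uΔ =
  Unique-resp-↭ (↭.map⁺ proj₁ (↭-sym s))
    (subst Unique (sym (List.map-++ proj₁ Γ Δ)) (Unique.++⁺ uΓ uΔ Γ#Δ))

Unique-dom-↭-++⁻ : ∀ Γ Δ → Θ ↭ Γ ++ Δ → Unique (dom Θ) → Unique (dom Γ) × Γ # Δ
Unique-dom-↭-++⁻ Γ Δ s u =
  let uΓ , _ , Γ#Δ = Unique-++⁻ (dom Γ)
                       (subst Unique (List.map-++ proj₁ Γ Δ) (Unique-resp-↭ (↭.map⁺ proj₁ s) u))
  in  uΓ , Γ#Δ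

≈-∈ˡ : Θ ≈ Γ ,, Δ → q ∈ Θ → proj₁ q ∈ dom Γ → q ∈ Γ
≈-∈ˡ {Γ = Γ} (s , Γ#Δ) q∈Θ q∈Γ with ∈-++⁻ Γ (↭.∈-resp-↭ s q∈Θ)
... | inj₁ q∈Γ' = q∈Γ'
... | inj₂ q∈Δ  = ⊥-elim (Γ#Δ (q∈Γ , ∈-dom q∈Δ))

≈-∈ʳ : Θ ≈ Γ ,, Δ → q ∈ Θ → proj₁ q ∈ dom Δ → q ∈ Δ
≈-∈ʳ = ≈-∈ˡ ∘ ≈-comm

≈-rotate : Θ ≈ Γ₁ ,, Δ → Δ ≈ Γ₂ ,, Γ₃ → Θ ≈ Γ₂ ,, (Γ₁ ++ Γ₃) × Γ₁ # Γ₃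
≈-rotate {Γ₁ = Γ₁} {Γ₂ = Γ₂} {Γ₃ = Γ₃} (s , Γ₁#Δ) t@(t↭ , Γ₂#Γ₃) =
  (↭-trans s (↭-trans (↭.++⁺ˡ Γ₁ t↭) (↭.shifts Γ₁ Γ₂)) , #-++ʳ Γ₁ Γ₃ (#-sym Γ₁#Γ₂) Γ₂#Γ₃) , Γ₁#Γ₃
  where
  Γ₁#Γ₂ : Γ₁ # Γ₂
  Γ₁#Γ₂ = Disjoint-⊆ id (≈-⊆ˡ Γ₂ Γ₃ t) Γ₁#Δ
  Γ₁#Γ₃ : Γ₁ # Γ₃
  Γ₁#Γ₃ = Disjoint-⊆ id (≈-⊆ʳ Γ₂ Γ₃ t) Γ₁#Δ

≈-replaceˡ : Θ ≈ Γ₁ ,, Γ₂ → Θ ↭ q ∷ Δ → q ∈ Γ₁ → Γ # Δ →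
             ∃ λ Γ₁' → Γ₁ ↭ q ∷ Γ₁' × Γ # Γ₁' × (Γ ++ Δ) ≈ (Γ ++ Γ₁') ,, Γ₂
≈-replaceˡ {Γ₂ = Γ₂} {Δ = Δ} {Γ = Γ} (s , Γ₁#Γ₂) p q∈Γ₁ Γ#Δ with ∈⇒↭∷ q∈Γ₁
... | Γ₁' , e = Γ₁' , e , Γ#Γ₁' , (Γ++Δ↭ , #-sym (#-++ʳ Γ Γ₁' Γ₂#Γ Γ₂#Γ₁'))
  where
  Δ≈ : Δ ≈ Γ₁' ,, Γ₂
  Δ≈ = ↭.drop-∷ (↭-trans (↭-sym p) (↭-trans s (↭.++⁺ʳ Γ₂ e))) ,
       Disjoint-⊆ (dom-⊆-↭ (↭-sym e) ∘ there) id Γ₁#Γ₂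
  Γ#Γ₁' : Γ # Γ₁'
  Γ#Γ₁' = Disjoint-⊆ id (≈-⊆ˡ Γ₁' Γ₂ Δ≈) Γ#Δ
  Γ₂#Γ : Γ₂ # Γ
  Γ₂#Γ = #-sym (Disjoint-⊆ id (≈-⊆ʳ Γ₁' Γ₂ Δ≈) Γ#Δ)
  Γ₂#Γ₁' : Γ₂ # Γ₁'
  Γ₂#Γ₁' = #-sym (proj₂ Δ≈)
  Γ++Δ↭ : Γ ++ Δ ↭ (Γ ++ Γ₁') ++ Γ₂
  Γ++Δ↭ = ↭-trans (↭.++⁺ˡ Γ (proj₁ Δ≈)) (↭-sym (↭.++-assoc Γ Γ₁' Γ₂))

≈-replaceʳ : Θ ≈ Γ₁ ,, Γ₂ → Θ ↭ q ∷ Δ → q ∈ Γ₂ → Γ # Δ →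
             ∃ λ Γ₂' → Γ₂ ↭ q ∷ Γ₂' × Γ # Γ₂' × (Γ ++ Δ) ≈ Γ₁ ,, (Γ ++ Γ₂')
≈-replaceʳ s p q∈Γ₂ Γ#Δ with ≈-replaceˡ (≈-comm s) p q∈Γ₂ Γ#Δ
... | Γ₂' , e , Γ#Γ₂' , s' = Γ₂' , e , Γ#Γ₂' , ≈-comm s'

⊢-resp-↭ : Θ ↭ Θ' → Θ ⊢ M ∶ τ → Θ' ⊢ M ∶ τ
⊢-resp-↭ p T-var with ↭.↭-singleton-inv (↭-sym p)
... | refl = T-var
⊢-resp-↭ p (T-weak d x∉ q)             = T-weak d x∉ (↭-trans (↭-sym p) q)
⊢-resp-↭ p (T-share d q xs≢[] x∉ q')   = T-share d q xs≢[] x∉ (↭-trans (↭-sym p) q')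
⊢-resp-↭ p (T-abs d q x∉)              = T-abs d (↭-trans q (prep _ p)) (x∉ ∘ dom-⊆-↭ (↭-sym p))
⊢-resp-↭ p (T-app d dB (s , Γ#Δ))      = T-app d dB (↭-trans (↭-sym p) s , Γ#Δ)
⊢-resp-↭ p (T-esub dB d q (s , Γ#Δ))   = T-esub dB d q (↭-trans (↭-sym p) s , Γ#Δ)
⊢-resp-↭ p (T-lsub dN d q (s , Γ#Δ))   = T-lsub dN d q (↭-trans (↭-sym p) s , Γ#Δ)

mutual
  ⊢-Unique-dom : Θ ⊢ M ∶ τ → Unique (dom Θ)
  ⊢-Unique-dom T-var                 = [] ∷ []
  ⊢-Unique-dom (T-weak d x∉ p)       = Unique-dom-≈ (≈-singleton p x∉) ([] ∷ []) (⊢-Unique-dom d)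
  ⊢-Unique-dom (T-share {Δ = Δ} {xs = xs} {σ = σ} d p _ x∉ p') =
    Unique-dom-≈ (≈-singleton p' x∉) ([] ∷ []) (proj₁ (Unique-dom-↭-++⁻ Δ (lins σ xs) p (⊢-Unique-dom d)))
  ⊢-Unique-dom (T-abs d p _)         = proj₂ (Unique-dom-∷⁻ p (⊢-Unique-dom d))
  ⊢-Unique-dom (T-app d dB s)        = Unique-dom-≈ s (⊢-Unique-dom d) (⊢ᵇ-Unique-dom dB)
  ⊢-Unique-dom (T-esub dB d p s)     =
    Unique-dom-≈ s (⊢ᵇ-Unique-dom dB) (proj₂ (Unique-dom-∷⁻ p (⊢-Unique-dom d)))
  ⊢-Unique-dom (T-lsub dN d p s)     =
    Unique-dom-≈ s (⊢-Unique-dom dN) (proj₂ (Unique-dom-∷⁻ p (⊢-Unique-dom d)))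

  ⊢ᵇ-Unique-dom : Θ ⊢ᵇ B ∶ π → Unique (dom Θ)
  ⊢ᵇ-Unique-dom T-one          = []
  ⊢ᵇ-Unique-dom (T-bag d dB s) = Unique-dom-≈ s (⊢-Unique-dom d) (⊢ᵇ-Unique-dom dB)

mutual
  ⊢-dom⊆fv : Θ ⊢ M ∶ τ → dom Θ ⊆ fv M
  ⊢-dom⊆fv T-var z∈Θ = z∈Θ
  ⊢-dom⊆fv (T-weak d _ p) z∈Θ with dom-⊆-↭ p z∈Θ
  ... | here z≡x  = here z≡x
  ... | there z∈Γ = there (∈-minus⁺ (⊢-dom⊆fv d z∈Γ) λ ())
  ⊢-dom⊆fv (T-share {Δ = Δ} {xs = xs} {σ = σ} d p _ _ p') z∈Θ with dom-⊆-↭ p' z∈Θ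
  ... | here z≡x  = here z≡x
  ... | there z∈Δ = there (∈-minus⁺ (⊢-dom⊆fv d (dom-⊆-↭ (↭-sym p) (dom-⊆-++ˡ Δ _ z∈Δ)))
                      λ z∈xs → Δ#xs (z∈Δ , subst (_ ∈_) (sym (dom-lins σ xs)) z∈xs))
    where
    Δ#xs : Δ # lins σ xs
    Δ#xs = proj₂ (Unique-dom-↭-++⁻ Δ (lins σ xs) p (⊢-Unique-dom d))
  ⊢-dom⊆fv (T-abs d p x∉) z∈Δ with ⊢-dom⊆fv d (dom-⊆-↭ (↭-sym p) (there z∈Δ))
  ... | here refl  = ⊥-elim (x∉ z∈Δ)
  ... | there z∈fv = z∈fv
  ⊢-dom⊆fv (T-app {Γ = Γ} {Δ = Δ} d dB s) z∈Θ with ≈-dom⁻ Γ Δ s z∈Θ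
  ... | inj₁ z∈Γ = ∈-++⁺ˡ (⊢-dom⊆fv d z∈Γ)
  ... | inj₂ z∈Δ = ∈-++⁺ʳ _ (⊢ᵇ-dom⊆fvs dB z∈Δ)
  ⊢-dom⊆fv (T-esub {Γ = Γ} {Δ = Δ} dB d p s) z∈Θ with ≈-dom⁻ Γ Δ s z∈Θ
  ... | inj₁ z∈Γ = ∈-++⁺ʳ _ (⊢ᵇ-dom⊆fvs dB z∈Γ)
  ... | inj₂ z∈Δ with ⊢-dom⊆fv d (dom-⊆-↭ (↭-sym p) (there z∈Δ))
  ...   | here refl  = ⊥-elim (proj₁ (Unique-dom-∷⁻ p (⊢-Unique-dom d)) z∈Δ)
  ...   | there z∈fv = ∈-++⁺ˡ z∈fv
  ⊢-dom⊆fv (T-lsub {Γ = Γ} {Δ = Δ} dN d p s) z∈Θ with ≈-dom⁻ Γ Δ s z∈Θ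
  ... | inj₁ z∈Γ = ∈-++⁺ʳ _ (⊢-dom⊆fv dN z∈Γ)
  ... | inj₂ z∈Δ = ∈-++⁺ˡ (∈-minus⁺ (⊢-dom⊆fv d (dom-⊆-↭ (↭-sym p) (there z∈Δ)))
                     λ { (here refl) → proj₁ (Unique-dom-∷⁻ p (⊢-Unique-dom d)) z∈Δ })

  ⊢ᵇ-dom⊆fvs : Θ ⊢ᵇ B ∶ π → dom Θ ⊆ fvs B
  ⊢ᵇ-dom⊆fvs (T-bag {Γ = Γ} {Δ = Δ} d dB s) z∈Θ with ≈-dom⁻ Γ Δ s z∈Θ
  ... | inj₁ z∈Γ = ∈-++⁺ˡ (⊢-dom⊆fv d z∈Γ)
  ... | inj₂ z∈Δ = ∈-++⁺ʳ _ (⊢ᵇ-dom⊆fvs dB z∈Δ)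

-- Linear head substitution

headShare-var : ∀ h → headShare h vs y ≡ var x → (h ≡ var x × x ∉ vs) ⊎ x ≡ y
headShare-var {vs = vs} (var z) e with z ∈? vs
headShare-var (var z) refl | yes _   = inj₂ refl
headShare-var (var z) refl | no z∉vs = inj₁ (refl , z∉vs)

headShare-≡var : headShare M vs y ≡ var x → x ≢ y → M ≡ var x
headShare-≡var {M = M} e x≢y with headShare-var M e
... | inj₁ (e' , _) = e'
... | inj₂ x≡y      = ⊥-elim (x≢y x≡y)

bv-share⊆bv-esub : ∀ M vs y B → bv (share M vs y) ⊆ bv (esub M vs y B)
bv-share⊆bv-esub M vs y B = there ∘ ⊆.++⁺ʳ vs (⊆.xs⊆xs++ys (bv M) (bvs B))

head-∈-dom : Θ ⊢ M ∶ τ → x ∉ bv M → head M ≡ var x → x ∈ dom Θ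
head-∈-dom T-var _ refl = here refl
head-∈-dom {M = share M₀ _ _} (T-weak d _ p) x∉ e with headShare-var (head M₀) e
... | inj₁ (e₀ , _) = dom-⊆-↭ (↭-sym p) (there (head-∈-dom d x∉ e₀))
... | inj₂ refl     = dom-⊆-↭ (↭-sym p) (here refl)
head-∈-dom {M = share M₀ vs _} (T-share {Δ = Δ} d p _ _ p') x∉ e with headShare-var (head M₀) e
... | inj₂ refl        = dom-⊆-↭ (↭-sym p') (here refl)
... | inj₁ (e₀ , x∉vs) with dom-lins-++⁻ Δ (dom-⊆-↭ p (head-∈-dom d (x∉ ∘ ∈-++⁺ʳ vs) e₀))
...   | inj₁ x∈Δ  = dom-⊆-↭ (↭-sym p') (there x∈Δ)
...   | inj₂ x∈vs = ⊥-elim (x∉vs x∈vs)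
head-∈-dom (T-app {Γ = Γ} {Δ = Δ} d _ s) x∉ e =
  ≈-⊆ˡ Γ Δ s (head-∈-dom d (x∉ ∘ ∈-++⁺ˡ) e)
head-∈-dom {M = esub M₀ vs y B} (T-esub {Γ = Γ} {Δ = Δ} _ d p s) x∉ e =
  ≈-⊆ʳ Γ Δ s (dom-∷⁻ p (head-∈-dom d (x∉ ∘ bv-share⊆bv-esub M₀ vs y B) e) λ { refl → x∉ (here refl) })
head-∈-dom (T-lsub {Γ = Γ} {Δ = Δ} _ d p s) x∉ e =
  ≈-⊆ʳ Γ Δ s (dom-∷⁻ p (head-∈-dom d (x∉ ∘ there ∘ ∈-++⁺ˡ) e) λ { refl → x∉ (here refl) })

⊢-HSub : HSub M N x M' → head M ≡ var x → Disjoint (bv M) (x ∷ dom Γ) →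
         Θ ⊢ M ∶ τ → Θ ↭ (x , lin σ) ∷ Δ → Γ ⊢ N ∶ σ → Γ # Δ → (Γ ++ Δ) ⊢ M' ∶ τ
⊢-HSub {Γ = Γ} hs-var _ _ T-var p dN _ with ↭.↭-singleton-inv (↭-sym p)
... | refl = ⊢-resp-↭ (↭-sym (↭.++-identityʳ Γ)) dN
⊢-HSub {x = x} {Γ = Γ} {σ = σ} (hs-app {M = M₀} h) e bv# (T-app {Γ = Γ₁} d dB s) p dN Γ#Δ =
  let _ , e₁ , Γ#Γ₁' , s' = ≈-replaceˡ s p q∈Γ₁ Γ#Δ
  in  T-app (⊢-HSub h e bv#₀ d e₁ dN Γ#Γ₁') dB s'
  where
  bv#₀ : Disjoint (bv M₀) (x ∷ dom Γ)
  bv#₀ = Disjoint-⊆ ∈-++⁺ˡ id bv#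
  q∈Γ₁ : (x , lin σ) ∈ Γ₁
  q∈Γ₁ = ≈-∈ˡ s (∈-head p) (head-∈-dom d (Disjoint[xs,y∷ys]⇒y∉xs bv#₀) e)
⊢-HSub {x = x} {Γ = Γ} (hs-lsub {M = M₀} {y = y} h) e bv#
       (T-lsub {Δ = Δ₀} {σ = σ₀} dL d p' s) p dN Γ#Δ =
  let _ , e₁ , Γ#Δ₀' , s' = ≈-replaceʳ s p (≈-∈ʳ s (∈-head p) x∈Δ₀) Γ#Δ
  in  T-lsub dL (⊢-HSub h e bv#₀ d (↭-∷-under p' e₁) dN (Disjoint-∷ʳ y∉Γ Γ#Δ₀'))
             (↭.shift (y , lin σ₀) Γ _) s'
  where
  bv#₀ : Disjoint (bv M₀) (x ∷ dom Γ)
  bv#₀ = Disjoint-⊆ (there ∘ ∈-++⁺ˡ) id bv#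
  y∉Γ : y ∉ dom Γ
  y∉Γ y∈Γ = bv# (here refl , there y∈Γ)
  x∈Δ₀ : x ∈ dom Δ₀
  x∈Δ₀ = dom-∷⁻ p' (head-∈-dom d (Disjoint[xs,y∷ys]⇒y∉xs bv#₀) e)
           λ { refl → bv# (here refl , here refl) }
⊢-HSub (hs-share x≢y h) e bv# (T-weak d y∉Γ₀ p') p dN Γ#Δ =
  let _ , e₁ , Γ#Γ₀' , s' = ≈-replaceʳ (≈-singleton p' y∉Γ₀) p (∈-mul∷⁻ (↭.∈-resp-↭ p' (∈-head p))) Γ#Δ
  in  T-weak (⊢-HSub h (headShare-≡var e x≢y) bv# d e₁ dN Γ#Γ₀')
             (Disjoint[xs,y∷ys]⇒y∉xs (Disjoint.sym (proj₂ s'))) (proj₁ s')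
⊢-HSub {x = x} {Γ = Γ} (hs-share {M = M₀} {ys = ys} x≢y h) e bv#
       (T-share {σ = σ₀} d p₁ ys≢[] y∉Δ₀ p₂) p dN Γ#Δ =
  let Δ₀' , e₁ , Γ#Δ₀' , s' = ≈-replaceʳ (≈-singleton p₂ y∉Δ₀) p (∈-mul∷⁻ (↭.∈-resp-↭ p₂ (∈-head p))) Γ#Δ
  in  T-share (⊢-HSub h (headShare-≡var e x≢y) bv#₀ d (↭-trans p₁ (↭.++⁺ʳ _ e₁)) dN
                (#-++ʳ Δ₀' (lins σ₀ ys) Γ#Δ₀' Γ#ys))
              (↭-sym (↭.++-assoc Γ Δ₀' _)) ys≢[]
              (Disjoint[xs,y∷ys]⇒y∉xs (Disjoint.sym (proj₂ s'))) (proj₁ s')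
  where
  bv#₀ : Disjoint (bv M₀) (x ∷ dom Γ)
  bv#₀ = Disjoint-⊆ (∈-++⁺ʳ ys) id bv#
  Γ#ys : Γ # lins σ₀ ys
  Γ#ys = #-sym (subst (λ vs → Disjoint vs (dom Γ)) (sym (dom-lins σ₀ ys)) (Disjoint-⊆ ∈-++⁺ˡ there bv#))
⊢-HSub {x = x} {Γ = Γ} (hs-esub {M = M₀} {ys = ys} {y = y} {B = B} x≢y h) e bv#
       (T-esub {Δ = Δ₀} {σ = σ₀} {k = k} dB d p' s) p dN Γ#Δ =
  let _ , e₁ , Γ#Δ₀' , s' = ≈-replaceʳ s p (≈-∈ʳ s (∈-head p) x∈Δ₀) Γ#Δ
  in  T-esub dB (⊢-HSub (hs-share x≢y h) e bv#₀ d (↭-∷-under p' e₁) dN (Disjoint-∷ʳ y∉Γ Γ#Δ₀'))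
             (↭.shift (y , mul (σ₀ ^ k)) Γ _) s'
  where
  bv#₀ : Disjoint (bv (share M₀ ys y)) (x ∷ dom Γ)
  bv#₀ = Disjoint-⊆ (bv-share⊆bv-esub M₀ ys y B) id bv#
  y∉Γ : y ∉ dom Γ
  y∉Γ y∈Γ = bv# (here refl , there y∈Γ)
  x∈Δ₀ : x ∈ dom Δ₀
  x∈Δ₀ = dom-∷⁻ p' (head-∈-dom d (Disjoint[xs,y∷ys]⇒y∉xs bv#₀) e) x≢y

-- Explicit substitution

-- Unlike  Γ ⊢ᵇ B ∶ σ ^ k  this form can be matched on, and it is invariant
-- under permuting the bag.
infix 4 _⊢ᵇ_∶*_

data _⊢ᵇ_∶*_ : Ctx → Bag → Strict → Set where
  []   : [] ⊢ᵇ [] ∶* σ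
  cons : Γ₁ ⊢ M ∶ σ → Γ₂ ⊢ᵇ B ∶* σ → Θ ≈ Γ₁ ,, Γ₂ → Θ ⊢ᵇ M ∷ B ∶* σ

⊢ᵇ⇒⊢ᵇ* : Γ ⊢ᵇ B ∶ π → π ≡ σ ^ length B → Γ ⊢ᵇ B ∶* σ
⊢ᵇ⇒⊢ᵇ* T-one          _  = []
⊢ᵇ⇒⊢ᵇ* (T-bag d dB s) eq with List.∷-injective eq
... | refl , eq' = cons d (⊢ᵇ⇒⊢ᵇ* dB eq') s

⊢ᵇ*-resp-↭ : B ↭ B' → Γ ⊢ᵇ B ∶* σ → Γ ⊢ᵇ B' ∶* σ
⊢ᵇ*-resp-↭ refl         dB                       = dB
⊢ᵇ*-resp-↭ (prep _ p)   (cons d dB s)            = cons d (⊢ᵇ*-resp-↭ p dB) s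
⊢ᵇ*-resp-↭ (swap _ _ p) (cons d₁ (cons d₂ dB t) s) =
  let s' , Γ₁#Γ₃ = ≈-rotate s t
  in  cons d₂ (cons d₁ (⊢ᵇ*-resp-↭ p dB) (↭-refl , Γ₁#Γ₃)) s'
⊢ᵇ*-resp-↭ (trans p p') dB                       = ⊢ᵇ*-resp-↭ p' (⊢ᵇ*-resp-↭ p dB)

⊢-lsubs : ∀ vs → length Ns ≡ length vs → Γ ⊢ᵇ Ns ∶* σ → Θ ⊢ M ∶ τ → Θ ↭ Δ ++ lins σ vs →
          Γ # Δ → Disjoint (dom Γ) vs → (Γ ++ Δ) ⊢ lsubs M vs Ns ∶ τ
⊢-lsubs []       _  []                 d p _ _ = ⊢-resp-↭ (↭-trans p (↭.++-identityʳ _)) d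
⊢-lsubs {Γ = Γ} {σ = σ} {Δ = Δ} (v ∷ vs) eq (cons {Γ₁ = Γ₁} {Γ₂ = Γ₂} dN dNs s) d p Γ#Δ Γ#v∷vs =
  ⊢-resp-↭ Γ₂++Γ₁++Δ↭
    (⊢-lsubs vs (suc-injective eq) dNs (T-lsub dN d (↭-trans p (↭.shift _ Δ _)) (↭-refl , Γ₁#Δvs))
      (↭-sym (↭.++-assoc Γ₁ Δ _)) Γ₂#Γ₁Δ Γ₂#vs)
  where
  Γ₁#Δvs : Γ₁ # (Δ ++ lins σ vs)
  Γ₁#Δvs = #-++ʳ Δ (lins σ vs) (Disjoint-⊆ (≈-⊆ˡ Γ₁ Γ₂ s) id Γ#Δ)
             (subst (Disjoint (dom Γ₁)) (sym (dom-lins σ vs)) (Disjoint-⊆ (≈-⊆ˡ Γ₁ Γ₂ s) there Γ#v∷vs))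
  Γ₂#Γ₁Δ : Γ₂ # (Γ₁ ++ Δ)
  Γ₂#Γ₁Δ = #-++ʳ Γ₁ Δ (#-sym (proj₂ s)) (Disjoint-⊆ (≈-⊆ʳ Γ₁ Γ₂ s) id Γ#Δ)
  Γ₂#vs : Disjoint (dom Γ₂) vs
  Γ₂#vs = Disjoint-⊆ (≈-⊆ʳ Γ₁ Γ₂ s) there Γ#v∷vs
  Γ₂++Γ₁++Δ↭ : Γ₂ ++ Γ₁ ++ Δ ↭ Γ ++ Δ
  Γ₂++Γ₁++Δ↭ = ↭-sym (↭-trans (↭.++⁺ʳ Δ (proj₁ s)) (↭-trans (↭.++-assoc Γ₁ Γ₂ Δ) (↭.shifts Γ₁ Γ₂)))

VarConv-app : ∀ M B → VarConv (app M B) → VarConv M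
VarConv-app M B (u , bv#fv) = proj₁ (Unique-++⁻ (bv M) u) , Disjoint-⊆ ∈-++⁺ˡ ∈-++⁺ˡ bv#fv

VarConv-lsub : ∀ M N x → VarConv (lsub M N x) → VarConv M
VarConv-lsub M N x (x∉ ∷ u , bv#fv) = proj₁ (Unique-++⁻ (bv M) u) , λ (z∈bv , z∈fv) →
  bv#fv (there (∈-++⁺ˡ z∈bv) , ∈-++⁺ˡ (∈-minus⁺ z∈fv λ { (here refl) → All.lookup x∉ (∈-++⁺ˡ z∈bv) refl }))

VarConv-share : ∀ M vs x → VarConv (share M vs x) → VarConv M
VarConv-share M vs x (u , bv#fv) =
  let _ , uM , vs#bvM = Unique-++⁻ vs u
  in  uM , λ (z∈bv , z∈fv) →
        bv#fv (∈-++⁺ʳ vs z∈bv , there (∈-minus⁺ z∈fv λ z∈vs → vs#bvM (z∈vs , z∈bv)))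

VarConv-esub : ∀ M vs x B → VarConv (esub M vs x B) → VarConv (share M vs x)
VarConv-esub M vs x B (x∉ ∷ u , bv#fv) =
  proj₁ (Unique-++⁻ (vs ++ bv M) (subst Unique (sym (List.++-assoc vs (bv M) (bvs B))) u)) , λ
  { (z∈bv , here refl)   → All.lookup x∉ (⊆.++⁺ʳ vs (⊆.xs⊆xs++ys (bv M) (bvs B)) z∈bv) refl
  ; (z∈bv , there z∈fv) → bv#fv (bv-share⊆bv-esub M vs x B z∈bv , ∈-++⁺ˡ z∈fv) }

⊢-β : Γ ⊢ lam x M vs ∶ (π ⇒ τ) → Δ ⊢ᵇ B ∶ π → Θ ≈ Γ ,, Δ → Θ ⊢ esub M vs x B ∶ τ
⊢-β (T-abs d p _) dB s = T-esub dB d p (≈-comm s)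

⊢-lin : VarConv (lsub M N x) → head M ≡ var x → HSub M N x M' → Θ ⊢ lsub M N x ∶ τ → Θ ⊢ M' ∶ τ
⊢-lin {M = M} {x = x} (x∉ ∷ _ , bv#fv) e h (T-lsub {Γ = Γ} dN d p (s , Γ#Δ)) =
  ⊢-resp-↭ (↭-sym s) (⊢-HSub h e bv# d p dN Γ#Δ)
  where
  bv# : Disjoint (bv M) (x ∷ dom Γ)
  bv# (z∈bv , here refl)  = All.lookup x∉ (∈-++⁺ˡ z∈bv) refl
  bv# (z∈bv , there z∈Γ) = bv#fv (there (∈-++⁺ˡ z∈bv) , ∈-++⁺ʳ _ (⊢-dom⊆fv dN z∈Γ))

mul-injective : mul π ≡ mul π' → π ≡ π'
mul-injective refl = refl

⊢-exsub : VarConv (esub M vs x B) → length B ≡ length vs → length vs ≢ 0 →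
          Θ ⊢ esub M vs x B ∶ τ → B' ↭ B → Θ ⊢ lsubs M vs B' ∶ τ
⊢-exsub _ _ k≢0 (T-esub _ (T-weak _ _ _) _ _) _ = ⊥-elim (k≢0 refl)
⊢-exsub {M = M} {vs = vs} {B = B} (_ , bv#fv) |B|≡k _
        (T-esub {Γ = Γ} {Δ = Δ} dB (T-share {Δ = Δ₀} {σ = σ₀} d p₁ _ x∉Δ₀ p₂) p (s , Γ#Δ)) B'↭B
  with ↭-∷-fresh-injective p p₂ x∉Δ₀
... | σᵏ≡σ₀ᵏ , Δ↭Δ₀ =
  ⊢-resp-↭ (↭-sym (↭-trans s (↭.++⁺ˡ Γ Δ↭Δ₀)))
    (⊢-lsubs vs (≡.trans (↭.↭-length B'↭B) |B|≡k) (⊢ᵇ*-resp-↭ (↭-sym B'↭B) dB*) d p₁ Γ#Δ₀ Γ#vs)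
  where
  dB* : Γ ⊢ᵇ B ∶* σ₀
  dB* = ⊢ᵇ⇒⊢ᵇ* dB (≡.trans (mul-injective σᵏ≡σ₀ᵏ) (cong (σ₀ ^_) (sym |B|≡k)))
  Γ#Δ₀ : Γ # Δ₀
  Γ#Δ₀ = Disjoint-⊆ id (dom-⊆-↭ (↭-sym Δ↭Δ₀)) Γ#Δ
  Γ#vs : Disjoint (dom Γ) vs
  Γ#vs (z∈Γ , z∈vs) = bv#fv (there (∈-++⁺ˡ z∈vs) , ∈-++⁺ʳ (fv M minus vs) (⊢ᵇ-dom⊆fvs dB z∈Γ))

subject-reduction : VarConv M → Θ ⊢ M ∶ τ → M ⟶ 𝕄 → All (λ M' → Θ ⊢ M' ∶ τ) 𝕄
subject-reduction _  (T-app d dB s) r-beta                = ⊢-β d dB s ∷ []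
subject-reduction vc d              (r-exsub |B|≡k k≢0) =
  All.map⁺ (All.tabulate (⊢-exsub vc |B|≡k k≢0 d ∘ perms-↭ _))
subject-reduction vc d              (r-lin e h)           = ⊢-lin vc e h d ∷ []
subject-reduction {M = app M B} vc (T-app d dB s) (c-app r) =
  All.map⁺ (All.map (λ d' → T-app d' dB s) (subject-reduction (VarConv-app M B vc) d r))
subject-reduction {M = lsub M N x} vc (T-lsub dN d p s) (c-lsub r) =
  All.map⁺ (All.map (λ d' → T-lsub dN d' p s) (subject-reduction (VarConv-lsub M N x vc) d r))
subject-reduction {M = share M vs x} vc (T-weak d x∉ p) (c-share r) =
  All.map⁺ (All.map (λ d' → T-weak d' x∉ p) (subject-reduction (VarConv-share M vs x vc) d r))
subject-reduction {M = share M vs x} vc (T-share d p₁ vs≢[] x∉ p₂) (c-share r) =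
  All.map⁺ (All.map (λ d' → T-share d' p₁ vs≢[] x∉ p₂)
    (subject-reduction (VarConv-share M vs x vc) d r))
subject-reduction {M = esub M vs x B} vc (T-esub dB d p s) (c-esub r) =
  All.map⁺ (All.map (λ d' → T-esub dB d' p s)
    (All.map⁻ (subject-reduction (VarConv-esub M vs x B vc) d (c-share r))))

⟶-nonempty : M ⟶ 𝕄 → 𝕄 ≢ []
⟶-nonempty r-beta                 ()
⟶-nonempty (r-exsub {B = B} _ _) = map-≢[] _ (perms-≢[] B)
⟶-nonempty (r-lin _ _)            ()
⟶-nonempty (c-app r)              = map-≢[] _ (⟶-nonempty r)
⟶-nonempty (c-lsub r)             = map-≢[] _ (⟶-nonempty r)
⟶-nonempty (c-share r)            = map-≢[] _ (⟶-nonempty r)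
⟶-nonempty (c-esub r)             = map-≢[] _ (⟶-nonempty r)

⊢ₑ⇒All : Γ ⊢ₑ 𝕄 ∶ τ → All (λ M → Γ ⊢ M ∶ τ) 𝕄
⊢ₑ⇒All (T-term d)   = d ∷ []
⊢ₑ⇒All (T-sum d d𝕄) = d ∷ ⊢ₑ⇒All d𝕄

All⇒⊢ₑ : 𝕄 ≢ [] → All (λ M → Γ ⊢ M ∶ τ) 𝕄 → Γ ⊢ₑ 𝕄 ∶ τ
All⇒⊢ₑ 𝕄≢[] []                 = ⊥-elim (𝕄≢[] refl)
All⇒⊢ₑ _    (d ∷ [])           = T-term d
All⇒⊢ₑ _    (d ∷ d𝕄@(_ ∷ _)) = T-sum d (All⇒⊢ₑ (λ ()) d𝕄)

theorem3p13 : (Γ : Ctx) (𝕄 𝕄' : Expr) (τ : Strict) →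
    VarConvₑ 𝕄 → Γ ⊢ₑ 𝕄 ∶ τ → 𝕄 ⟶ₑ 𝕄' → Γ ⊢ₑ 𝕄' ∶ τ
theorem3p13 _ _ _ _ vc d (c-sum {𝕃 = 𝕃} {𝕄 = 𝕄} {ℕ' = ℕ'} r)
  with All.++⁻ 𝕃 (⊢ₑ⇒All d) | All.++⁻ʳ 𝕃 vc
... | d𝕃 , dM ∷ dℕ | vcM ∷ _ =
  All⇒⊢ₑ (⟶-nonempty r ∘ List.++-conicalˡ 𝕄 ℕ' ∘ List.++-conicalʳ 𝕃 _)
    (All.++⁺ d𝕃 (All.++⁺ (subject-reduction vcM dM r) dℕ))
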